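{- Let $k$ be a positive integer and $d$ an integer with $d>4k-1-d$. There is a self-complementary graph on $4k$ vertices in which $2k$ vertices have degree $d$ and $2k$ vertices have degree $4k-1-d$ (i.e., with degree sequence $(d^{2k},(4k-1-d)^{2k})$) if and only if $2k\le d\le 3k-1$. Moreover, when $2k\le d\le 3k-1$, there exists such a self-complementary graph having an antimorphism that consists of a single cycle (of length $4k$).
   Context: Graphs are finite and simple. A graph $G$ is self-complementary if it is isomorphic to its complement $\overline G$; an isomorphism from $G$ to $\overline G$, viewed as a permutation of $V(G)$, is an antimorphism. The compact notation $(d_1^{n_1},\dots,d_\ell^{n_\ell})$ for a degree sequence requires $d_1>\dots>d_\ell$ and means $n_i$ vertices of degree $d_i$. -}

module Defs where

open import Data.Nat using (ℕ; zero; suc)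
open import Data.Bool using (Bool; true; false; not)
open import Data.Fin using (Fin)
open import Data.Fin.Properties using (_≟_)
open import Data.List using (List; length; filter)
open import Data.List using () renaming (allFin to allFinL)
open import Data.Product using (Σ; ∃; _×_; _,_)
open import Data.Integer using (ℤ; +_)
open import Data.Integer.Properties using () renaming (_≟_ to _≟ℤ_)
open import Function.Bundles using (_↔_; Inverse)
open import Relation.Binary.PropositionalEquality using (_≡_; _≢_)
open import Relation.Nullary using (¬_; does)

record Graph (n : ℕ) : Set where
  field
    adj   : Fin n → Fin n → Bool
    sym   : ∀ u v → adj u v ≡ adj v u
    irrefl : ∀ v → adj v v ≡ false
open Graph public

degree : ∀ {n} → Graph n → Fin n → ℕ
degree G v = length (filter (λ u → adj G v u ≟b true) (allFinL _))
  where
    open import Data.Bool.Properties using () renaming (_≟_ to _≟b_)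

countDeg : ∀ {n} → Graph n → ℤ → ℕ
countDeg G e = length (filter (λ v → (+ degree G v) ≟ℤ e) (allFinL _))

coAdj : ∀ {n} → Graph n → Fin n → Fin n → Bool
coAdj G u v with does (u ≟ v)
... | true  = false
... | false = not (adj G u v)

IsAntimorphism : ∀ {n} → Graph n → (Fin n ↔ Fin n) → Set
IsAntimorphism G σ = ∀ u v → coAdj G (Inverse.to σ u) (Inverse.to σ v) ≡ adj G u v

SelfComplementary : ∀ {n} → Graph n → Set
SelfComplementary G = Σ (_ ↔ _) (IsAntimorphism G)

iter : ∀ {A : Set} → (A → A) → ℕ → A → A
iter f zero    x = x
iter f (suc i) x = f (iter f i x)

SingleCycle : ∀ {n} → (Fin n ↔ Fin n) → Set
SingleCycle {n} σ = ∀ u v → ∃ λ i → iter (Inverse.to σ) i u ≡ v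

{-# OPTIONS --safe #-}

-- Necessity is double counting: the 2k vertices of degree d have at most 2k·2k edge-ends among
-- themselves, and every other edge-end at one of them belongs to an edge towards a vertex of degree
-- 4k−1−d, so 2k·d ≤ 2k·2k + 2k·(4k−1−d), i.e. d ≤ 3k−1; and d > 4k−1−d forces d ≥ 2k.
--
-- For sufficiency take the vertex set ℤ/N with N = 4k and a pattern h on differences: u ~ v iff
-- v − u ≠ 0 and h (v − u) differs from the parity of u. Adding 1 flips every parity and keeps
-- differences, so u ↦ u + 1 is an antimorphism consisting of one N-cycle. The relation is symmetric
-- as soon as h (N − δ) = h δ xor odd δ, which holds for the reflection of any pattern on [0, 2k].
-- Even vertices then have degree #{δ | h δ} and odd ones the complementary degree. Taking h true on
-- [1, 2a], on the odd numbers of (2a, 2k), and equal to b at 2k gives degree k + 2a + b, which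
-- covers every d with 2k ≤ d ≤ 3k−1.

module Submission where

open import Data.Nat.Base as ℕ using (ℕ)
open import Data.Bool.Base using (Bool; false)
open import Relation.Binary.PropositionalEquality using (_≡_)

module Sums where

  open import Data.Nat.Base using (ℕ; zero; suc; _+_; _*_; _∸_; _≤_; _<_; z≤n; s≤s)
  open import Data.Nat.Properties using (+-*-semiring; +-mono-≤; +-assoc; *-identityʳ; n≮n; m+n∸n≡m)
  open import Data.Bool.Base using (Bool; true; false; not)
  open import Data.Fin.Base using (Fin; zero; suc; toℕ)
  open import Data.List.Base using (length; filter; tabulate)
  open import Data.Product.Base using (_×_; _,_)
  open import Data.Empty using (⊥-elim)
  open import Function.Base using (_∘_)
  open import Relation.Binary.PropositionalEquality
  open import Relation.Nullary using (does)
  open import Relation.Unary using (Pred; Decidable)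

  open import Algebra.Properties.Semiring.Sum +-*-semiring public
    using (sum; sum-syntax; sum-cong-≗; sum-replicate-zero; ∑-comm; ∑-distrib-+; *-distribˡ-sum; *-distribʳ-sum)

  𝟙 : Bool → ℕ
  𝟙 true  = 1
  𝟙 false = 0

  𝟙≤1 : ∀ b → 𝟙 b ≤ 1
  𝟙≤1 true  = s≤s z≤n
  𝟙≤1 false = z≤n

  𝟙-not : ∀ b → 𝟙 (not b) + 𝟙 b ≡ 1
  𝟙-not true  = refl
  𝟙-not false = refl

  length-filter-tabulate : ∀ {a p} {A : Set a} {P : Pred A p} (P? : Decidable P) {n} (f : Fin n → A) →
                           length (filter P? (tabulate f)) ≡ ∑[ i < n ] 𝟙 (does (P? (f i)))
  length-filter-tabulate P? {zero}  f = refl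
  length-filter-tabulate P? {suc n} f with does (P? (f zero))
  ... | true  = cong suc (length-filter-tabulate P? (f ∘ suc))
  ... | false = length-filter-tabulate P? (f ∘ suc)

  sum-mono-≤ : ∀ {n} {f g : Fin n → ℕ} → (∀ i → f i ≤ g i) → sum f ≤ sum g
  sum-mono-≤ {zero}  _   = z≤n
  sum-mono-≤ {suc n} f≤g = +-mono-≤ (f≤g zero) (sum-mono-≤ (f≤g ∘ suc))

  sum-bits-≤ : ∀ {n} {f : Fin n → ℕ} → (∀ i → f i ≤ 1) → sum f ≤ n
  sum-bits-≤ {zero}  _   = z≤n
  sum-bits-≤ {suc n} f≤1 = +-mono-≤ (f≤1 zero) (sum-bits-≤ (f≤1 ∘ suc))

  sum-bits-full : ∀ {n} {f : Fin n → ℕ} → (∀ i → f i ≤ 1) → sum f ≡ n → ∀ i → f i ≡ 1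
  sum-bits-full {suc n} f≤1 eq i with bit+rest (f≤1 zero) (sum-bits-≤ (f≤1 ∘ suc)) eq
    where
    bit+rest : ∀ {x s m} → x ≤ 1 → s ≤ m → x + s ≡ suc m → x ≡ 1 × s ≡ m
    bit+rest {0}           _         s≤m refl = ⊥-elim (n≮n _ s≤m)
    bit+rest {1}           _         _   refl = refl , refl
    bit+rest {suc (suc _)} (s≤s ()) _   _
  sum-bits-full f≤1 eq zero    | f₀≡1 , _      = f₀≡1
  sum-bits-full f≤1 eq (suc i) | _    , rest≡n = sum-bits-full (f≤1 ∘ suc) rest≡n i

  sumBelow : ℕ → (ℕ → ℕ) → ℕ
  sumBelow n f = ∑[ i < n ] f (toℕ i)

  sumBelow-cong : ∀ n {f g : ℕ → ℕ} → (∀ i → i < n → f i ≡ g i) → sumBelow n f ≡ sumBelow n g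
  sumBelow-cong zero    _   = refl
  sumBelow-cong (suc n) f≡g = cong₂ _+_ (f≡g 0 (s≤s z≤n)) (sumBelow-cong n (λ i i<n → f≡g (suc i) (s≤s i<n)))

  sumBelow-+ : ∀ m n f → sumBelow (m + n) f ≡ sumBelow m f + sumBelow n (λ i → f (m + i))
  sumBelow-+ zero    n f = refl
  sumBelow-+ (suc m) n f = trans (cong (f 0 +_) (sumBelow-+ m n (f ∘ suc))) (sym (+-assoc (f 0) _ _))

  sumBelow-const : ∀ n c → sumBelow n (λ _ → c) ≡ n * c
  sumBelow-const zero    c = refl
  sumBelow-const (suc n) c = cong (c +_) (sumBelow-const n c)

  sumBelow-not : ∀ n (p : ℕ → Bool) → sumBelow n (λ i → 𝟙 (not (p i))) ≡ n ∸ sumBelow n (λ i → 𝟙 (p i))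
  sumBelow-not n p = trans (sym (m+n∸n≡m _ (sumBelow n (𝟙 ∘ p)))) (cong (_∸ sumBelow n (𝟙 ∘ p)) complement)
    where
    complement : sumBelow n (λ i → 𝟙 (not (p i))) + sumBelow n (λ i → 𝟙 (p i)) ≡ n
    complement = begin
      sumBelow n (λ i → 𝟙 (not (p i))) + sumBelow n (λ i → 𝟙 (p i))
        ≡⟨ ∑-distrib-+ {n} (λ i → 𝟙 (not (p (toℕ i)))) (λ i → 𝟙 (p (toℕ i))) ⟨
      sumBelow n (λ i → 𝟙 (not (p i)) + 𝟙 (p i))  ≡⟨ sum-cong-≗ {n} (𝟙-not ∘ p ∘ toℕ) ⟩
      sumBelow n (λ _ → 1)                        ≡⟨ sumBelow-const n 1 ⟩
      n * 1                                       ≡⟨ *-identityʳ n ⟩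
      n                                           ∎
      where open ≡-Reasoning

  sumBelow-bits-≤ : ∀ n (p : ℕ → Bool) → sumBelow n (λ i → 𝟙 (p i)) ≤ n
  sumBelow-bits-≤ n p = sum-bits-≤ (λ i → 𝟙≤1 (p (toℕ i)))


module Parity where

  open import Data.Nat.Base using (ℕ; zero; suc; _+_; _∸_; _≤_)
  open import Data.Nat.Properties using (+-assoc; +-suc; +-comm; +-identityʳ; m∸n+n≡m)
  open import Data.Bool.Base using (Bool; true; false; not; _xor_)
  open import Data.Product.Base using (∃₂; _,_)
  open import Data.Bool.Properties using (not-distribˡ-xor; xor-same; xor-assoc; xor-identityʳ)
  open import Function.Base using (_∘_)
  open import Relation.Binary.PropositionalEquality
  open Sums

  odd : ℕ → Bool
  odd zero    = false
  odd (suc n) = not (odd n)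

  odd-+ : ∀ m n → odd (m + n) ≡ odd m xor odd n
  odd-+ zero    n = refl
  odd-+ (suc m) n = trans (cong not (odd-+ m n)) (not-distribˡ-xor (odd m) (odd n))

  odd-double : ∀ n → odd (n + n) ≡ false
  odd-double n = trans (odd-+ n n) (xor-same (odd n))

  sumBelow-odd : ∀ j c → sumBelow (j + j) (λ i → 𝟙 (odd (c + i))) ≡ j
  sumBelow-odd zero    c = refl
  sumBelow-odd (suc j) c rewrite +-suc j j = begin
    𝟙 (odd (c + 0)) + (𝟙 (odd (c + 1)) + sumBelow (j + j) (λ i → 𝟙 (odd (c + suc (suc i)))))
      ≡⟨ +-assoc (𝟙 (odd (c + 0))) _ _ ⟨
    𝟙 (odd (c + 0)) + 𝟙 (odd (c + 1)) + sumBelow (j + j) (λ i → 𝟙 (odd (c + suc (suc i))))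
      ≡⟨ cong₂ _+_ one-of-two (sumBelow-cong (j + j) (λ i _ → cong (𝟙 ∘ odd) (shift i))) ⟩
    1 + sumBelow (j + j) (λ i → 𝟙 (odd (suc (suc c) + i)))
      ≡⟨ cong suc (sumBelow-odd j (suc (suc c))) ⟩
    suc j
      ∎
    where
    open ≡-Reasoning
    one-of-two : 𝟙 (odd (c + 0)) + 𝟙 (odd (c + 1)) ≡ 1
    one-of-two rewrite +-identityʳ c | +-comm c 1 = trans (+-comm (𝟙 (odd c)) _) (𝟙-not (odd c))
    shift : ∀ i → c + suc (suc i) ≡ suc (suc c) + i
    shift i = trans (+-suc c (suc i)) (cong suc (+-suc c i))

  xor-cancelʳ : ∀ x y → (x xor y) xor y ≡ x
  xor-cancelʳ x y = trans (xor-assoc x y y) (trans (cong (x xor_) (xor-same y)) (xor-identityʳ x))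

  odd-∸ : ∀ {m n} → n ≤ m → odd (m ∸ n) ≡ odd m xor odd n
  odd-∸ {m} {n} n≤m = begin
    odd (m ∸ n)                        ≡⟨ xor-cancelʳ (odd (m ∸ n)) (odd n) ⟨
    (odd (m ∸ n) xor odd n) xor odd n  ≡⟨ cong (_xor odd n) (odd-+ (m ∸ n) n) ⟨
    odd (m ∸ n + n) xor odd n          ≡⟨ cong (λ x → odd x xor odd n) (m∸n+n≡m n≤m) ⟩
    odd m xor odd n                    ∎
    where open ≡-Reasoning

  halve : ∀ t → ∃₂ λ a b → t ≡ a + a + 𝟙 b
  halve zero = 0 , false , refl
  halve (suc t) with halve t
  ... | a , false , t≡2a   = a , true , trans (cong suc t≡2a) (sym (+-suc (a + a) 0))
  ... | a , true  , t≡2a+1 = suc a , false , cong suc (begin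
    t              ≡⟨ t≡2a+1 ⟩
    a + a + 1      ≡⟨ +-assoc a a 1 ⟩
    a + (a + 1)    ≡⟨ cong (a +_) (+-comm a 1) ⟩
    a + suc a      ≡⟨ +-identityʳ (a + suc a) ⟨
    a + suc a + 0  ∎)
    where open ≡-Reasoning

  ParitySymmetric : ℕ → (ℕ → Bool) → Set
  ParitySymmetric N h = ∀ δ → δ ≤ N → h (N ∸ δ) ≡ h δ xor odd δ

module GraphCounting where

  open import Data.Nat.Base using (ℕ; _+_; _*_; _≤_; z≤n; s≤s)
  open import Data.Nat.Properties using (≤-refl; module ≤-Reasoning)
  open import Data.Bool.Base using (Bool; true; false; not)
  open import Data.Bool.Properties using (not-involutive) renaming (_≟_ to _≟ᵇ_)
  open import Data.Fin.Base using (Fin)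
  open import Data.Fin.Properties using (_≟_)
  open import Data.Integer.Base using (+_; -[1+_])
  open import Data.Integer.Properties using () renaming (_≟_ to _≟ℤ_)
  open import Data.Empty using (⊥-elim)
  open import Function.Base using (id; _∘_)
  open import Function.Bundles using (_↔_; Inverse; Injection)
  open import Function.Properties.Inverse using (↔⇒↣)
  open import Relation.Binary.PropositionalEquality
  open import Relation.Nullary using (Dec; does; yes; no)
  open import Defs hiding (sym)
  open Sums

  degree-as-sum : ∀ {n} (G : Graph n) u → degree G u ≡ ∑[ v < n ] 𝟙 (adj G u v)
  degree-as-sum {n} G u = trans (length-filter-tabulate (λ v → adj G u v ≟ᵇ true) {n} id)
                                (sum-cong-≗ (λ v → 𝟙-≟-true (adj G u v)))
    where
    𝟙-≟-true : ∀ b → 𝟙 (does (b ≟ᵇ true)) ≡ 𝟙 b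
    𝟙-≟-true true  = refl
    𝟙-≟-true false = refl

  countDeg-as-sum : ∀ {n} (G : Graph n) e → countDeg G e ≡ ∑[ v < n ] 𝟙 (does (+ degree G v ≟ℤ e))
  countDeg-as-sum {n} G e = length-filter-tabulate (λ v → + degree G v ≟ℤ e) {n} id

  countDeg-negative : ∀ {n} (G : Graph n) x → countDeg G -[1+ x ] ≡ 0
  countDeg-negative {n} G x = trans (countDeg-as-sum G -[1+ x ]) (sum-replicate-zero n)

  coAdj-refl : ∀ {n} (G : Graph n) u → coAdj G u u ≡ false
  coAdj-refl G u with u ≟ u
  ... | yes _   = refl
  ... | no  u≢u = ⊥-elim (u≢u refl)

  coAdj-≢ : ∀ {n} (G : Graph n) {u v} → u ≢ v → coAdj G u v ≡ not (adj G u v)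
  coAdj-≢ G {u} {v} u≢v with u ≟ v
  ... | yes u≡v = ⊥-elim (u≢v u≡v)
  ... | no  _   = refl

  antimorphism : ∀ {n} (G : Graph n) (σ : Fin n ↔ Fin n) →
                 (∀ u v → u ≢ v → adj G (Inverse.to σ u) (Inverse.to σ v) ≡ not (adj G u v)) →
                 IsAntimorphism G σ
  antimorphism G σ flips u v with u ≟ v
  ... | yes refl = trans (coAdj-refl G (Inverse.to σ v)) (sym (irrefl G v))
  ... | no  u≢v  = trans (coAdj-≢ G (u≢v ∘ Injection.injective (↔⇒↣ σ)))
                         (trans (cong not (flips u v u≢v)) (not-involutive (adj G u v)))

  module _ {n} (G : Graph n) where

    hasDegree : ℕ → Fin n → ℕ
    hasDegree d v = 𝟙 (does (+ degree G v ≟ℤ + d))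

    hasDegree-* : ∀ d v → hasDegree d v * degree G v ≡ hasDegree d v * d
    hasDegree-* d v = by-cases (+ degree G v ≟ℤ + d)
      where
      by-cases : (D : Dec (+ degree G v ≡ + d)) → 𝟙 (does D) * degree G v ≡ 𝟙 (does D) * d
      by-cases (yes refl) = refl
      by-cases (no  _)    = refl

    hasDegree-exclusive : ∀ {m m′} → m ≢ m′ → ∀ v → hasDegree m v + hasDegree m′ v ≤ 1
    hasDegree-exclusive {m} {m′} m≢m′ v = by-cases (+ degree G v ≟ℤ + m) (+ degree G v ≟ℤ + m′)
      where
      by-cases : (D : Dec (+ degree G v ≡ + m)) (D′ : Dec (+ degree G v ≡ + m′)) → 𝟙 (does D) + 𝟙 (does D′) ≤ 1
      by-cases (yes refl) (yes refl) = ⊥-elim (m≢m′ refl)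
      by-cases (yes _)    (no  _)    = ≤-refl
      by-cases (no  _)    (yes _)    = ≤-refl
      by-cases (no  _)    (no  _)    = z≤n

    ∑-hasDegree-* : ∀ d → ∑[ u < n ] (hasDegree d u * degree G u) ≡ countDeg G (+ d) * d
    ∑-hasDegree-* d = trans (sum-cong-≗ (hasDegree-* d))
                            (trans (sym (*-distribʳ-sum d (hasDegree d))) (cong (_* d) (sym (countDeg-as-sum G (+ d)))))

    two-degree-bound : ∀ {m m′} → m ≢ m′ → countDeg G (+ m) + countDeg G (+ m′) ≡ n →
                       countDeg G (+ m) * m ≤ countDeg G (+ m) * countDeg G (+ m) + countDeg G (+ m′) * m′
    two-degree-bound {m} {m′} m≢m′ covers = begin
      K * m                                                ≡⟨ ∑-hasDegree-* m ⟨
      ∑[ u < n ] (A u * degree G u)                        ≡⟨ sum-cong-≗ expand ⟩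
      ∑[ u < n ] ∑[ v < n ] (A u * E u v)                  ≤⟨ sum-mono-≤ (λ u → sum-mono-≤ (neighbour-bound u)) ⟩
      ∑[ u < n ] ∑[ v < n ] (A u * A v + B v * E v u)      ≡⟨ split ⟩
      ∑[ u < n ] ∑[ v < n ] (A u * A v) + ∑[ u < n ] ∑[ v < n ] (B v * E v u)
                                                           ≡⟨ cong₂ _+_ square (∑-comm (λ u v → B v * E v u)) ⟩
      K * K + ∑[ v < n ] ∑[ u < n ] (B v * E v u)          ≡⟨ cong (λ s → K * K + s) (sum-cong-≗ contract) ⟩
      K * K + ∑[ v < n ] (B v * degree G v)                ≡⟨ cong (λ s → K * K + s) (∑-hasDegree-* m′) ⟩
      K * K + K′ * m′                                      ∎
      where
      open ≤-Reasoning
      A B : Fin n → ℕ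
      A = hasDegree m
      B = hasDegree m′
      E : Fin n → Fin n → ℕ
      E u v = 𝟙 (adj G u v)
      K K′ : ℕ
      K  = countDeg G (+ m)
      K′ = countDeg G (+ m′)

      partition : ∀ v → A v + B v ≡ 1
      partition = sum-bits-full (hasDegree-exclusive m≢m′)
        (trans (∑-distrib-+ A B) (trans (cong₂ _+_ (sym (countDeg-as-sum G (+ m))) (sym (countDeg-as-sum G (+ m′)))) covers))

      neighbour-bound : ∀ u v → A u * E u v ≤ A u * A v + B v * E v u
      neighbour-bound u v rewrite Graph.sym G u v = bit-bound (deg≟ u m) (deg≟ v m) (deg≟ v m′) (adj G v u) (partition v)
        where
        deg≟ : Fin n → ℕ → Bool
        deg≟ w d = does (+ degree G w ≟ℤ + d)
        bit-bound : ∀ p q r e → 𝟙 q + 𝟙 r ≡ 1 → 𝟙 p * 𝟙 e ≤ 𝟙 p * 𝟙 q + 𝟙 r * 𝟙 e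
        bit-bound false q     r     e     _  = z≤n
        bit-bound true  q     r     false _  = z≤n
        bit-bound true  true  r     true  _  = s≤s z≤n
        bit-bound true  false true  true  _  = s≤s z≤n
        bit-bound true  false false true  ()

      expand : ∀ u → A u * degree G u ≡ ∑[ v < n ] (A u * E u v)
      expand u = trans (cong (A u *_) (degree-as-sum G u)) (*-distribˡ-sum (A u) (E u))

      split : ∑[ u < n ] ∑[ v < n ] (A u * A v + B v * E v u)
            ≡ ∑[ u < n ] ∑[ v < n ] (A u * A v) + ∑[ u < n ] ∑[ v < n ] (B v * E v u)
      split = trans (sum-cong-≗ (λ u → ∑-distrib-+ (λ v → A u * A v) (λ v → B v * E v u)))
                    (∑-distrib-+ {n} (λ u → ∑[ v < n ] (A u * A v)) (λ u → ∑[ v < n ] (B v * E v u)))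

      square : ∑[ u < n ] ∑[ v < n ] (A u * A v) ≡ K * K
      square = trans (sum-cong-≗ (λ u → sym (*-distribˡ-sum (A u) A)))
                     (trans (sym (*-distribʳ-sum (sum A) A)) (cong (λ s → s * s) (sym (countDeg-as-sum G (+ m)))))

      contract : ∀ v → ∑[ u < n ] (B v * E v u) ≡ B v * degree G v
      contract v = trans (sym (*-distribˡ-sum (B v) (E v))) (cong (B v *_) (sym (degree-as-sum G v)))

module Rotation (M : ℕ) where

  open import Data.Nat.Base using (ℕ; zero; suc; _+_; _∸_; _%_; _<_)
  open import Data.Nat.Properties using (+-identityʳ; +-suc; +-comm; +-assoc; m+[n∸m]≡n; <⇒≤)
  open import Data.Nat.DivMod using (m<n⇒m%n≡m; n%n≡0; m%n<n; %-distribˡ-+; m%n%n≡m%n; [m+n]%n≡m%n)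
  open import Data.Fin.Base using (Fin; toℕ; fromℕ<)
  open import Data.Fin.Properties using (toℕ<n; toℕ-fromℕ<; toℕ-injective)
  open import Data.Product.Base using (_,_)
  open import Function.Bundles using (_↔_; mk↔ₛ′)
  open import Relation.Binary.PropositionalEquality
  open import Defs using (iter; SingleCycle)

  N : ℕ
  N = suc M

  next : ℕ → ℕ
  next x = suc x % N

  next-< : ∀ {x} → suc x < N → next x ≡ suc x
  next-< = m<n⇒m%n≡m

  next<N : ∀ x → next x < N
  next<N x = m%n<n (suc x) N

  next-wrap : ∀ {x} → suc x ≡ N → next x ≡ 0
  next-wrap {x} sx≡N = trans (cong (_% N) sx≡N) (n%n≡0 N)

  %-absorbˡ : ∀ x y → (x % N + y) % N ≡ (x + y) % N
  %-absorbˡ x y = begin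
    (x % N + y) % N               ≡⟨ %-distribˡ-+ (x % N) y N ⟩
    (x % N % N + y % N) % N       ≡⟨ cong (λ z → (z + y % N) % N) (m%n%n≡m%n x N) ⟩
    (x % N + y % N) % N           ≡⟨ %-distribˡ-+ x y N ⟨
    (x + y) % N                   ∎
    where open ≡-Reasoning

  %-absorbʳ : ∀ x y → (y + x % N) % N ≡ (y + x) % N
  %-absorbʳ x y = trans (cong (_% N) (+-comm y (x % N))) (trans (%-absorbˡ x y) (cong (_% N) (+-comm x y)))

  full-turn : ∀ {i} → i < N → suc (i + M) % N ≡ i
  full-turn {i} i<N = trans (cong (_% N) (sym (+-suc i M))) (trans ([m+n]%n≡m%n i N) (m<n⇒m%n≡m i<N))

  forward backward : Fin N → Fin N
  forward  i = fromℕ< (m%n<n (suc (toℕ i)) N)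
  backward i = fromℕ< (m%n<n (toℕ i + M) N)

  toℕ-forward : ∀ i → toℕ (forward i) ≡ next (toℕ i)
  toℕ-forward i = toℕ-fromℕ< (m%n<n (suc (toℕ i)) N)

  forward-backward : ∀ i → forward (backward i) ≡ i
  forward-backward i = toℕ-injective (begin
    toℕ (forward (backward i))     ≡⟨ toℕ-forward (backward i) ⟩
    suc (toℕ (backward i)) % N     ≡⟨ cong (λ z → suc z % N) (toℕ-fromℕ< (m%n<n (toℕ i + M) N)) ⟩
    (1 + (toℕ i + M) % N) % N      ≡⟨ %-absorbʳ (toℕ i + M) 1 ⟩
    suc (toℕ i + M) % N            ≡⟨ full-turn (toℕ<n i) ⟩
    toℕ i                          ∎)
    where open ≡-Reasoning

  backward-forward : ∀ i → backward (forward i) ≡ i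
  backward-forward i = toℕ-injective (begin
    toℕ (backward (forward i))     ≡⟨ toℕ-fromℕ< (m%n<n (toℕ (forward i) + M) N) ⟩
    (toℕ (forward i) + M) % N      ≡⟨ cong (λ z → (z + M) % N) (toℕ-forward i) ⟩
    (suc (toℕ i) % N + M) % N      ≡⟨ %-absorbˡ (suc (toℕ i)) M ⟩
    suc (toℕ i + M) % N            ≡⟨ full-turn (toℕ<n i) ⟩
    toℕ i                          ∎)
    where open ≡-Reasoning

  rotate : Fin N ↔ Fin N
  rotate = mk↔ₛ′ forward backward forward-backward backward-forward

  toℕ-iter-forward : ∀ i u → toℕ (iter forward i u) ≡ (toℕ u + i) % N
  toℕ-iter-forward zero    u = sym (trans (cong (_% N) (+-identityʳ (toℕ u))) (m<n⇒m%n≡m (toℕ<n u)))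
  toℕ-iter-forward (suc i) u = begin
    toℕ (forward (iter forward i u)) ≡⟨ toℕ-forward (iter forward i u) ⟩
    suc (toℕ (iter forward i u)) % N ≡⟨ cong (λ z → suc z % N) (toℕ-iter-forward i u) ⟩
    (1 + (toℕ u + i) % N) % N        ≡⟨ %-absorbʳ (toℕ u + i) 1 ⟩
    suc (toℕ u + i) % N              ≡⟨ cong (_% N) (+-suc (toℕ u) i) ⟨
    (toℕ u + suc i) % N              ∎
    where open ≡-Reasoning

  rotate-single-cycle : SingleCycle rotate
  rotate-single-cycle u v = N ∸ toℕ u + toℕ v , toℕ-injective (begin
    toℕ (iter forward (N ∸ toℕ u + toℕ v) u) ≡⟨ toℕ-iter-forward (N ∸ toℕ u + toℕ v) u ⟩
    (toℕ u + (N ∸ toℕ u + toℕ v)) % N        ≡⟨ cong (_% N) (+-assoc (toℕ u) (N ∸ toℕ u) (toℕ v)) ⟨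
    (toℕ u + (N ∸ toℕ u) + toℕ v) % N        ≡⟨ cong (λ z → (z + toℕ v) % N) (m+[n∸m]≡n (<⇒≤ (toℕ<n u))) ⟩
    (N + toℕ v) % N                          ≡⟨ cong (_% N) (+-comm N (toℕ v)) ⟩
    (toℕ v + N) % N                          ≡⟨ [m+n]%n≡m%n (toℕ v) N ⟩
    toℕ v % N                                ≡⟨ m<n⇒m%n≡m (toℕ<n v) ⟩
    toℕ v                                    ∎)
    where open ≡-Reasoning

module Circulant (M K : ℕ) (N≡K+K : ℕ.suc M ≡ K ℕ.+ K)
                 (h : ℕ → Bool) (h-sym : Parity.ParitySymmetric (ℕ.suc M) h) where

  open import Data.Nat.Base using (zero; suc; _+_; _∸_; _≤_; _<_; z≤n; s≤s; s≤s⁻¹)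
  open import Data.Nat.Properties
  open import Data.Bool.Base using (true; false; not; _xor_; if_then_else_)
  open import Data.Bool.Properties using (not-injective; not-distribʳ-xor; xor-identityʳ; xor-comm)
  open import Data.Fin.Base using (Fin; toℕ)
  open import Data.Fin.Properties using (toℕ<n; toℕ-injective)
  open import Data.Integer.Base using (+_)
  open import Data.Integer.Properties using (+-injective) renaming (_≟_ to _≟ℤ_)
  open import Data.Sum.Base using (inj₁; inj₂)
  open import Data.Empty using (⊥-elim)
  open import Function.Base using (_∘_)
  open import Relation.Binary.PropositionalEquality
  open import Relation.Binary.Definitions using (tri<; tri≈; tri>)
  open import Relation.Nullary using (¬_; does; yes; no)
  open import Relation.Nullary.Decidable using (dec-true; dec-false)
  open import Defs hiding (sym)
  open Sums
  open Parity
  open GraphCounting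
  open Rotation M

  M-odd : odd M ≡ true
  M-odd = not-injective (trans (cong odd N≡K+K) (odd-double K))

  gap : ℕ → ℕ → ℕ
  gap u v = if does (u ≤? v) then v ∸ u else N + v ∸ u

  gap-≤ : ∀ {u v} → u ≤ v → gap u v ≡ v ∸ u
  gap-≤ {u} {v} u≤v rewrite dec-true (u ≤? v) u≤v = refl

  gap-> : ∀ {u v} → ¬ u ≤ v → gap u v ≡ N + v ∸ u
  gap-> {u} {v} u≰v rewrite dec-false (u ≤? v) u≰v = refl

  gap-suc : ∀ u v → gap (suc u) (suc v) ≡ gap u v
  gap-suc u v with u ≤? v
  ... | yes u≤v = trans (gap-≤ (s≤s u≤v)) (sym (gap-≤ u≤v))
  ... | no  u≰v = trans (gap-> (u≰v ∘ s≤s⁻¹)) (trans (cong (_∸ suc u) (+-suc N v)) (sym (gap-> u≰v)))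

  gap-≢0 : ∀ {u v} → u < N → u ≢ v → gap u v ≢ 0
  gap-≢0 {u} {v} u<N u≢v with u ≤? v
  ... | yes u≤v = λ gap≡0 → u≢v (≤-antisym u≤v (m∸n≡0⇒m≤n (trans (sym (gap-≤ u≤v)) gap≡0)))
  ... | no  u≰v = λ gap≡0 → <⇒≱ u<N (m+n≤o⇒m≤o N (m∸n≡0⇒m≤n (trans (sym (gap-> u≰v)) gap≡0)))

  edge : Bool → ℕ → Bool
  edge p zero    = false
  edge p (suc δ) = h (suc δ) xor p

  edge-not : ∀ p {δ} → δ ≢ 0 → edge (not p) δ ≡ not (edge p δ)
  edge-not p {zero}  δ≢0 = ⊥-elim (δ≢0 refl)
  edge-not p {suc δ} _   = sym (not-distribʳ-xor (h (suc δ)) p)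

  adjacent : ℕ → ℕ → Bool
  adjacent u v = edge (odd u) (gap u v)

  adjacent-irrefl : ∀ u → adjacent u u ≡ false
  adjacent-irrefl u = cong (edge (odd u)) (trans (gap-≤ {u} ≤-refl) (n∸n≡0 u))

  adjacent-sym-+ : ∀ u δ → 0 < δ → u + δ < N → adjacent u (u + δ) ≡ adjacent (u + δ) u
  adjacent-sym-+ u δ@(suc δ-1) _ u+δ<N = begin
    edge (odd u) (gap u (u + δ))             ≡⟨ cong (edge (odd u)) (trans (gap-≤ (m≤m+n u δ)) (m+n∸m≡n u δ)) ⟩
    h δ xor odd u                            ≡⟨ common-xor-cancel (h δ) (odd u) (odd δ) ⟨
    (h δ xor odd δ) xor (odd u xor odd δ)    ≡⟨ cong₂ _xor_ (h-sym δ δ≤N) (odd-+ u δ) ⟨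
    h (N ∸ δ) xor odd (u + δ)                ≡⟨ edge-positive (N ∸ δ) (odd (u + δ)) N∸δ≢0 ⟨
    edge (odd (u + δ)) (N ∸ δ)               ≡⟨ cong (edge (odd (u + δ))) gap-back ⟨
    edge (odd (u + δ)) (gap (u + δ) u)       ∎
    where
    open ≡-Reasoning
    δ≤N : δ ≤ N
    δ≤N = ≤-trans (m≤n+m δ u) (<⇒≤ u+δ<N)
    N∸δ≢0 : N ∸ δ ≢ 0
    N∸δ≢0 N∸δ≡0 = <⇒≱ (≤-trans (s≤s (m≤n+m δ u)) u+δ<N) (m∸n≡0⇒m≤n N∸δ≡0)
    gap-back : gap (u + δ) u ≡ N ∸ δ
    gap-back = trans (gap-> (<⇒≱ (m<m+n u (s≤s z≤n))))
                     (trans (cong (_∸ (u + δ)) (+-comm N u)) ([m+n]∸[m+o]≡n∸o u N δ))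
    edge-positive : ∀ d p → d ≢ 0 → edge p d ≡ h d xor p
    edge-positive zero    p d≢0 = ⊥-elim (d≢0 refl)
    edge-positive (suc d) p _   = refl
    common-xor-cancel : ∀ x y z → (x xor z) xor (y xor z) ≡ x xor y
    common-xor-cancel x     y     false = cong₂ _xor_ (xor-identityʳ x) (xor-identityʳ y)
    common-xor-cancel true  true  true  = refl
    common-xor-cancel true  false true  = refl
    common-xor-cancel false true  true  = refl
    common-xor-cancel false false true  = refl

  adjacent-sym-< : ∀ {u v} → u < v → v < N → adjacent u v ≡ adjacent v u
  adjacent-sym-< {u} {v} u<v v<N = subst (λ w → adjacent u w ≡ adjacent w u) u+[v∸u]≡v
    (adjacent-sym-+ u (v ∸ u) (m<n⇒0<n∸m u<v) (subst (_< N) (sym u+[v∸u]≡v) v<N))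
    where
    u+[v∸u]≡v : u + (v ∸ u) ≡ v
    u+[v∸u]≡v = m+[n∸m]≡n (<⇒≤ u<v)

  adjacent-sym : ∀ {u v} → u < N → v < N → adjacent u v ≡ adjacent v u
  adjacent-sym {u} {v} u<N v<N with <-cmp u v
  ... | tri< u<v _ _  = adjacent-sym-< u<v v<N
  ... | tri≈ _ refl _ = refl
  ... | tri> _ _ v<u  = sym (adjacent-sym-< v<u u<N)

  adjacent-suc : ∀ {x y} → x < N → x ≢ y → adjacent (suc x) (suc y) ≡ not (adjacent x y)
  adjacent-suc {x} {y} x<N x≢y = trans (cong (edge (not (odd x))) (gap-suc x y)) (edge-not (odd x) (gap-≢0 x<N x≢y))

  adjacent-wrap : ∀ {y} → suc y < N → adjacent 0 (suc y) ≡ not (adjacent M y)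
  adjacent-wrap {y} sy<N = begin
    edge false (gap 0 (suc y))     ≡⟨ cong (edge false) (gap-≤ z≤n) ⟩
    h (suc y) xor false            ≡⟨ not-distribʳ-xor (h (suc y)) true ⟨
    not (h (suc y) xor true)       ≡⟨ cong (λ p → not (edge p (suc y))) M-odd ⟨
    not (edge (odd M) (suc y))     ≡⟨ cong (not ∘ edge (odd M)) gap-M-y ⟨
    not (edge (odd M) (gap M y))   ∎
    where
    open ≡-Reasoning
    gap-M-y : gap M y ≡ suc y
    gap-M-y = trans (gap-> (<⇒≱ (s≤s⁻¹ sy<N))) (trans (cong (_∸ M) (sym (+-suc M y))) (m+n∸m≡n M (suc y)))

  adjacent-next-wrap : ∀ {x y} → suc x ≡ N → suc y < N → adjacent (next x) (next y) ≡ not (adjacent x y)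
  adjacent-next-wrap {x} {y} sx≡N sy<N = trans (cong₂ adjacent (next-wrap sx≡N) (next-< sy<N))
    (subst (λ z → adjacent 0 (suc y) ≡ not (adjacent z y)) (sym (suc-injective sx≡N)) (adjacent-wrap sy<N))

  adjacent-next : ∀ {x y} → x < N → y < N → x ≢ y → adjacent (next x) (next y) ≡ not (adjacent x y)
  adjacent-next {x} {y} x<N y<N x≢y with m≤n⇒m<n∨m≡n x<N | m≤n⇒m<n∨m≡n y<N
  ... | inj₁ sx<N | inj₁ sy<N = trans (cong₂ adjacent (next-< sx<N) (next-< sy<N)) (adjacent-suc x<N x≢y)
  ... | inj₂ sx≡N | inj₂ sy≡N = ⊥-elim (x≢y (suc-injective (trans sx≡N (sym sy≡N))))
  ... | inj₂ sx≡N | inj₁ sy<N = adjacent-next-wrap sx≡N sy<N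
  ... | inj₁ sx<N | inj₂ sy≡N = begin
    adjacent (next x) (next y)  ≡⟨ adjacent-sym (next<N x) (next<N y) ⟩
    adjacent (next y) (next x)  ≡⟨ adjacent-next-wrap sy≡N sx<N ⟩
    not (adjacent y x)          ≡⟨ cong not (adjacent-sym y<N x<N) ⟩
    not (adjacent x y)          ∎
    where open ≡-Reasoning

  graph : Graph N
  graph = record
    { adj    = λ u v → adjacent (toℕ u) (toℕ v)
    ; sym    = λ u v → adjacent-sym (toℕ<n u) (toℕ<n v)
    ; irrefl = λ v → adjacent-irrefl (toℕ v)
    }

  rotate-antimorphism : IsAntimorphism graph rotate
  rotate-antimorphism = antimorphism graph rotate λ u v u≢v →
    trans (cong₂ adjacent (toℕ-forward u) (toℕ-forward v)) (adjacent-next (toℕ<n u) (toℕ<n v) (u≢v ∘ toℕ-injective))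

  evenDegree : ℕ
  evenDegree = sumBelow M (λ i → 𝟙 (h (suc i)))

  degreeAt : ℕ → ℕ
  degreeAt u = if odd u then M ∸ evenDegree else evenDegree

  sum-adjacent : ∀ {u} → u < N → sumBelow N (λ v → 𝟙 (adjacent u v)) ≡ sumBelow N (λ δ → 𝟙 (edge (odd u) δ))
  sum-adjacent {u} u<N = begin
    sumBelow N F                                           ≡⟨ cong (λ n → sumBelow n F) (m+[n∸m]≡n u≤N) ⟨
    sumBelow (u + (N ∸ u)) F                               ≡⟨ sumBelow-+ u (N ∸ u) F ⟩
    sumBelow u F + sumBelow (N ∸ u) (λ i → F (u + i))      ≡⟨ cong₂ _+_ before after ⟩
    sumBelow u (λ i → G (N ∸ u + i)) + sumBelow (N ∸ u) G  ≡⟨ +-comm (sumBelow u (λ i → G (N ∸ u + i))) _ ⟩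
    sumBelow (N ∸ u) G + sumBelow u (λ i → G (N ∸ u + i))  ≡⟨ sumBelow-+ (N ∸ u) u G ⟨
    sumBelow (N ∸ u + u) G                                 ≡⟨ cong (λ n → sumBelow n G) (m∸n+n≡m u≤N) ⟩
    sumBelow N G                                           ∎
    where
    open ≡-Reasoning
    u≤N : u ≤ N
    u≤N = <⇒≤ u<N
    F G : ℕ → ℕ
    F v = 𝟙 (adjacent u v)
    G δ = 𝟙 (edge (odd u) δ)
    before : sumBelow u F ≡ sumBelow u (λ i → G (N ∸ u + i))
    before = sumBelow-cong u (λ i i<u → cong (𝟙 ∘ edge (odd u)) (trans (gap-> (<⇒≱ i<u)) (+-∸-comm i u≤N)))
    after : sumBelow (N ∸ u) (λ i → F (u + i)) ≡ sumBelow (N ∸ u) G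
    after = sumBelow-cong (N ∸ u) (λ i _ → cong (𝟙 ∘ edge (odd u)) (trans (gap-≤ (m≤m+n u i)) (m+n∸m≡n u i)))

  sum-edge : ∀ p → sumBelow N (λ δ → 𝟙 (edge p δ)) ≡ (if p then M ∸ evenDegree else evenDegree)
  sum-edge false = sumBelow-cong M (λ i _ → cong 𝟙 (xor-identityʳ (h (suc i))))
  sum-edge true  = trans (sumBelow-cong M (λ i _ → cong 𝟙 (xor-comm (h (suc i)) true))) (sumBelow-not M (h ∘ suc))

  degree-graph : ∀ u → degree graph u ≡ degreeAt (toℕ u)
  degree-graph u = trans (degree-as-sum graph u) (trans (sum-adjacent (toℕ<n u)) (sum-edge (odd (toℕ u))))

  evenDegree≤M : evenDegree ≤ M
  evenDegree≤M = sumBelow-bits-≤ M (h ∘ suc)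

  oddDegree≢evenDegree : M ∸ evenDegree ≢ evenDegree
  oddDegree≢evenDegree eq with trans (sym M-odd) (trans (cong odd M≡e+e) (odd-double evenDegree))
    where
    M≡e+e : M ≡ evenDegree + evenDegree
    M≡e+e = trans (sym (m∸n+n≡m evenDegree≤M)) (cong (_+ evenDegree) eq)
  ... | ()

  countDeg-graph : ∀ e → countDeg graph e ≡ sumBelow N (λ x → 𝟙 (does (+ degreeAt x ≟ℤ e)))
  countDeg-graph e = trans (countDeg-as-sum graph e)
                           (sum-cong-≗ (λ v → cong (λ d → 𝟙 (does (+ d ≟ℤ e))) (degree-graph v)))

  countDeg-evenDegree : countDeg graph (+ evenDegree) ≡ K
  countDeg-evenDegree = begin
    countDeg graph (+ evenDegree)                  ≡⟨ countDeg-graph (+ evenDegree) ⟩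
    sumBelow N (λ x → 𝟙 (does (+ degreeAt x ≟ℤ + evenDegree))) ≡⟨ sumBelow-cong N (λ x _ → is-even x) ⟩
    sumBelow N (λ x → 𝟙 (odd (1 + x)))            ≡⟨ cong (λ n → sumBelow n (λ x → 𝟙 (odd (1 + x)))) N≡K+K ⟩
    sumBelow (K + K) (λ x → 𝟙 (odd (1 + x)))      ≡⟨ sumBelow-odd K 1 ⟩
    K                                              ∎
    where
    open ≡-Reasoning
    is-even : ∀ x → 𝟙 (does (+ degreeAt x ≟ℤ + evenDegree)) ≡ 𝟙 (odd (1 + x))
    is-even x with odd x
    ... | true  = cong 𝟙 (dec-false (+ (M ∸ evenDegree) ≟ℤ + evenDegree) (oddDegree≢evenDegree ∘ +-injective))
    ... | false = cong 𝟙 (dec-true (+ evenDegree ≟ℤ + evenDegree) refl)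

  countDeg-oddDegree : countDeg graph (+ (M ∸ evenDegree)) ≡ K
  countDeg-oddDegree = begin
    countDeg graph (+ (M ∸ evenDegree))                  ≡⟨ countDeg-graph (+ (M ∸ evenDegree)) ⟩
    sumBelow N (λ x → 𝟙 (does (+ degreeAt x ≟ℤ + (M ∸ evenDegree)))) ≡⟨ sumBelow-cong N (λ x _ → is-odd x) ⟩
    sumBelow N (λ x → 𝟙 (odd (0 + x)))                  ≡⟨ cong (λ n → sumBelow n (λ x → 𝟙 (odd x))) N≡K+K ⟩
    sumBelow (K + K) (λ x → 𝟙 (odd (0 + x)))            ≡⟨ sumBelow-odd K 0 ⟩
    K                                                    ∎
    where
    open ≡-Reasoning
    is-odd : ∀ x → 𝟙 (does (+ degreeAt x ≟ℤ + (M ∸ evenDegree))) ≡ 𝟙 (odd (0 + x))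
    is-odd x with odd x
    ... | true  = cong 𝟙 (dec-true (+ (M ∸ evenDegree) ≟ℤ + (M ∸ evenDegree)) refl)
    ... | false = cong 𝟙 (dec-false (+ evenDegree ≟ℤ + (M ∸ evenDegree)) (oddDegree≢evenDegree ∘ sym ∘ +-injective))

-- K must be even because δ = K is its own mirror image N − K.
module Reflection (N K : ℕ) (N≡K+K : N ≡ K ℕ.+ K) (K-even : Parity.odd K ≡ false)
                  (g : ℕ → Bool) where

  open import Data.Nat.Base using (_∸_; _≤_; _<_)
  open import Data.Nat.Properties
  open import Data.Bool.Base using (false; _xor_; if_then_else_)
  open import Data.Bool.Properties using (xor-identityʳ)
  open import Relation.Binary.PropositionalEquality
  open import Relation.Binary.Definitions using (tri<; tri≈; tri>)
  open import Relation.Nullary using (¬_; does)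
  open import Relation.Nullary.Decidable using (dec-true; dec-false)
  open Parity

  reflect : ℕ → Bool
  reflect δ = if does (δ ≤? K) then g δ else g (N ∸ δ) xor odd δ

  reflect-≤ : ∀ {δ} → δ ≤ K → reflect δ ≡ g δ
  reflect-≤ {δ} δ≤K rewrite dec-true (δ ≤? K) δ≤K = refl

  reflect-> : ∀ {δ} → ¬ δ ≤ K → reflect δ ≡ g (N ∸ δ) xor odd δ
  reflect-> {δ} δ≰K rewrite dec-false (δ ≤? K) δ≰K = refl

  K≤N : K ≤ N
  K≤N = subst (K ≤_) (sym N≡K+K) (m≤m+n K K)

  N∸K≡K : N ∸ K ≡ K
  N∸K≡K = trans (cong (_∸ K) N≡K+K) (m+n∸m≡n K K)

  odd-N∸ : ∀ {δ} → δ ≤ N → odd (N ∸ δ) ≡ odd δ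
  odd-N∸ {δ} δ≤N = trans (odd-∸ δ≤N) (cong (_xor odd δ) (trans (cong odd N≡K+K) (odd-double K)))

  reflect-symmetric : ParitySymmetric N reflect
  reflect-symmetric δ δ≤N with <-cmp δ K
  ... | tri< δ<K _ _ = begin
    reflect (N ∸ δ)                  ≡⟨ reflect-> (<⇒≱ K<N∸δ) ⟩
    g (N ∸ (N ∸ δ)) xor odd (N ∸ δ)  ≡⟨ cong₂ (λ x p → g x xor p) (m∸[m∸n]≡n δ≤N) (odd-N∸ δ≤N) ⟩
    g δ xor odd δ                    ≡⟨ cong (_xor odd δ) (reflect-≤ (<⇒≤ δ<K)) ⟨
    reflect δ xor odd δ              ∎
    where
    open ≡-Reasoning
    K<N∸δ : K < N ∸ δ
    K<N∸δ = subst (_< N ∸ δ) N∸K≡K (∸-monoʳ-< δ<K K≤N)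
  ... | tri≈ _ refl _ = begin
    reflect (N ∸ K)                  ≡⟨ cong reflect N∸K≡K ⟩
    reflect K                        ≡⟨ xor-identityʳ (reflect K) ⟨
    reflect K xor false              ≡⟨ cong (reflect K xor_) K-even ⟨
    reflect K xor odd K              ∎
    where open ≡-Reasoning
  ... | tri> _ _ K<δ = begin
    reflect (N ∸ δ)                  ≡⟨ reflect-≤ (<⇒≤ N∸δ<K) ⟩
    g (N ∸ δ)                        ≡⟨ xor-cancelʳ (g (N ∸ δ)) (odd δ) ⟨
    (g (N ∸ δ) xor odd δ) xor odd δ  ≡⟨ cong (_xor odd δ) (reflect-> (<⇒≱ K<δ)) ⟨
    reflect δ xor odd δ              ∎
    where
    open ≡-Reasoning
    N∸δ<K : N ∸ δ < K
    N∸δ<K = subst (N ∸ δ <_) N∸K≡K (∸-monoʳ-< K<δ δ≤N)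

module Pattern (a j : ℕ) (b : Bool) where

  open import Data.Nat.Base using (suc; _+_; _*_; _∸_; _≤_; _<_; s≤s; s≤s⁻¹)
  open import Data.Nat.Properties
  open import Data.Nat.Tactic.RingSolver using (solve-∀)
  open import Data.Bool.Base using (true; false; not; _∨_; _∧_; _xor_)
  open import Data.Bool.Properties using (∨-zeroʳ; ∨-identityʳ; xor-same)
  open import Data.Product.Base using (_,_)
  open import Function.Base using (_∘_)
  open import Relation.Binary.PropositionalEquality using (_≡_; _≢_; refl; sym; trans; cong; cong₂; subst; module ≡-Reasoning)
  open import Relation.Nullary using (¬_; does)
  open import Relation.Nullary.Decidable using (dec-true; dec-false)
  open Sums
  open Parity

  k K N A J : ℕ
  k = a + suc j
  K = k + k
  N = 4 * k
  A = a + a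
  J = suc (j + j)

  N≡K+K : N ≡ K + K
  N≡K+K = four a j
    where
    four : ∀ a j → 4 * (a + suc j) ≡ (a + suc j + (a + suc j)) + (a + suc j + (a + suc j))
    four = solve-∀

  K≡ : K ≡ suc (suc (A + (j + j)))
  K≡ = double a j
    where
    double : ∀ a j → a + suc j + (a + suc j) ≡ suc (suc (a + a + (j + j)))
    double = solve-∀

  halfPattern : ℕ → Bool
  halfPattern δ = odd δ ∨ does (δ ≤? A) ∨ (does (δ ≟ K) ∧ b)

  open Reflection N K N≡K+K (odd-double k) halfPattern public using (reflect; reflect-symmetric)
  open Reflection N K N≡K+K (odd-double k) halfPattern using (reflect-≤; reflect->; odd-N∸)

  halfPattern-low : ∀ {δ} → δ ≤ A → halfPattern δ ≡ true
  halfPattern-low {δ} δ≤A rewrite dec-true (δ ≤? A) δ≤A = ∨-zeroʳ (odd δ)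

  halfPattern-odd : ∀ {δ} → ¬ δ ≤ A → δ ≢ K → halfPattern δ ≡ odd δ
  halfPattern-odd {δ} δ≰A δ≢K rewrite dec-false (δ ≤? A) δ≰A | dec-false (δ ≟ K) δ≢K = ∨-identityʳ (odd δ)

  A<K : A < K
  A<K = subst (A <_) (sym K≡) (s≤s (m≤n⇒m≤1+n (m≤m+n A (j + j))))

  reflect-low : ∀ {i} → i < A → reflect (suc i) ≡ true
  reflect-low i<A = trans (reflect-≤ (<⇒≤ (≤-trans (s≤s i<A) A<K))) (halfPattern-low i<A)

  reflect-middle : ∀ {i} → i ≤ j + j → reflect (suc (A + i)) ≡ odd (suc (A + i))
  reflect-middle {i} i≤2j = trans (reflect-≤ (<⇒≤ δ<K)) (halfPattern-odd (m+n≮m A i) (<⇒≢ δ<K))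
    where
    δ<K : suc (A + i) < K
    δ<K = subst (suc (A + i) <_) (sym K≡) (s≤s (s≤s (+-monoʳ-≤ A i≤2j)))

  reflect-centre : reflect K ≡ b
  reflect-centre = trans (reflect-≤ ≤-refl) centre
    where
    centre : halfPattern K ≡ b
    centre rewrite odd-double k | dec-false (K ≤? A) (<⇒≱ A<K) | dec-true (K ≟ K) refl = refl

  reflect-above : ∀ {i} → i ≤ j + j → reflect (suc (K + i)) ≡ false
  reflect-above {i} i≤2j with m≤n⇒∃[o]m+o≡n i≤2j
  ... | r , i+r≡2j = begin
    reflect δ                          ≡⟨ reflect-> (m+n≮m K i) ⟩
    halfPattern (N ∸ δ) xor odd δ      ≡⟨ cong (_xor odd δ) (halfPattern-odd N∸δ≰A N∸δ≢K) ⟩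
    odd (N ∸ δ) xor odd δ              ≡⟨ cong (_xor odd δ) (odd-N∸ (subst (δ ≤_) (sym N≡δ+) (m≤m+n δ _))) ⟩
    odd δ xor odd δ                    ≡⟨ xor-same (odd δ) ⟩
    false                              ∎
    where
    open ≡-Reasoning
    δ : ℕ
    δ = suc (K + i)
    N≡δ+ : N ≡ δ + suc (A + r)
    N≡δ+ = begin
      N                                      ≡⟨ N≡K+K ⟩
      K + K                                  ≡⟨ cong (K +_) K≡ ⟩
      K + suc (suc (A + (j + j)))        ≡⟨ cong (λ x → K + suc (suc (A + x))) i+r≡2j ⟨
      K + suc (suc (A + (i + r)))        ≡⟨ rearrange K A i r ⟩
      suc (K + i) + suc (A + r)          ∎
      where
      rearrange : ∀ K A i r → K + suc (suc (A + (i + r))) ≡ suc (K + i) + suc (A + r)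
      rearrange = solve-∀
    N∸δ≡ : N ∸ δ ≡ suc (A + r)
    N∸δ≡ = trans (cong (_∸ δ) N≡δ+) (m+n∸m≡n δ _)
    N∸δ≰A : ¬ N ∸ δ ≤ A
    N∸δ≰A = subst (λ x → ¬ x ≤ A) (sym N∸δ≡) (m+n≮m A r)
    N∸δ≢K : N ∸ δ ≢ K
    N∸δ≢K N∸δ≡K = m+1+n≢m K (trans (cong (_+ suc i) (trans (sym N∸δ≡K) N∸δ≡)) [N∸δ]+1+i≡K)
      where
      [N∸δ]+1+i≡K : suc (A + r) + suc i ≡ K
      [N∸δ]+1+i≡K = begin
        suc (A + r) + suc i            ≡⟨ rearrange A i r ⟩
        suc (suc (A + (i + r)))        ≡⟨ cong (λ x → suc (suc (A + x))) i+r≡2j ⟩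
        suc (suc (A + (j + j)))        ≡⟨ K≡ ⟨
        K                                  ∎
        where
        rearrange : ∀ A i r → suc (A + r) + suc i ≡ suc (suc (A + (i + r)))
        rearrange = solve-∀

  reflect-high : ∀ {i} → i < A → reflect (suc (K + (J + i))) ≡ not (odd (suc (K + (J + i))))
  reflect-high {i} i<A with m≤n⇒∃[o]m+o≡n i<A
  ... | r , 1+i+r≡A = trans (reflect-> (m+n≮m K (J + i))) (cong (_xor odd δ) halfPattern-N∸δ)
    where
    open ≡-Reasoning
    δ : ℕ
    δ = suc (K + (J + i))
    N≡δ+ : N ≡ δ + suc r
    N≡δ+ = begin
      N                                      ≡⟨ N≡K+K ⟩
      K + K                                  ≡⟨ cong (K +_) K≡ ⟩
      K + suc (suc (A + (j + j)))            ≡⟨ cong (λ x → K + suc (suc (x + (j + j)))) 1+i+r≡A ⟨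
      K + suc (suc (suc (i + r) + (j + j)))  ≡⟨ rearrange K i r (j + j) ⟩
      δ + suc r                              ∎
      where
      rearrange : ∀ K i r J → K + suc (suc (suc (i + r) + J)) ≡ suc (K + (suc J + i)) + suc r
      rearrange = solve-∀
    N∸δ≡ : N ∸ δ ≡ suc r
    N∸δ≡ = trans (cong (_∸ δ) N≡δ+) (m+n∸m≡n δ (suc r))
    halfPattern-N∸δ : halfPattern (N ∸ δ) ≡ true
    halfPattern-N∸δ = subst (λ x → halfPattern x ≡ true) (sym N∸δ≡)
                            (halfPattern-low (subst (suc r ≤_) 1+i+r≡A (s≤s (m≤n+m r i))))

  N∸1≡blocks : N ∸ 1 ≡ A + (J + (1 + (J + A)))
  N∸1≡blocks = cong (_∸ 1) (lengths a j)
    where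
    lengths : ∀ a j → 4 * (a + suc j) ≡ suc ((a + a) + (suc (j + j) + (1 + (suc (j + j) + (a + a)))))
    lengths = solve-∀

  A+J+1+x≡K+x : ∀ x → A + (J + suc x) ≡ K + x
  A+J+1+x≡K+x = shift a j
    where
    shift : ∀ a j x → (a + a) + (suc (j + j) + suc x) ≡ (a + suc j + (a + suc j)) + x
    shift = solve-∀

  count-low : sumBelow A (λ i → 𝟙 (reflect (suc i))) ≡ A
  count-low = trans (sumBelow-cong A (λ i i<A → cong 𝟙 (reflect-low i<A))) (trans (sumBelow-const A 1) (*-identityʳ A))

  count-middle : sumBelow J (λ i → 𝟙 (reflect (suc (A + i)))) ≡ suc j
  count-middle = begin
    sumBelow J (λ i → 𝟙 (reflect (suc (A + i))))
      ≡⟨ sumBelow-cong J (λ i i<J → cong 𝟙 (reflect-middle (s≤s⁻¹ i<J))) ⟩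
    sumBelow J (λ i → 𝟙 (odd (suc (A + i))))
      ≡⟨ cong₂ _+_ (cong (𝟙 ∘ not) odd-A+0) (sumBelow-cong (j + j) shift) ⟩
    1 + sumBelow (j + j) (λ i → 𝟙 (odd (suc (suc A) + i)))
      ≡⟨ cong suc (sumBelow-odd j (suc (suc A))) ⟩
    suc j
      ∎
    where
    open ≡-Reasoning
    odd-A+0 : odd (A + 0) ≡ false
    odd-A+0 = trans (cong odd (+-identityʳ A)) (odd-double a)
    shift : ∀ i → i < j + j → 𝟙 (odd (suc (A + suc i))) ≡ 𝟙 (odd (suc (suc A) + i))
    shift i _ = cong (𝟙 ∘ odd ∘ suc) (+-suc A i)

  count-centre : 𝟙 (reflect (suc (A + (J + 0)))) ≡ 𝟙 b
  count-centre = cong 𝟙 (trans (cong reflect (centre-index a j)) reflect-centre)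
    where
    centre-index : ∀ a j → suc ((a + a) + (suc (j + j) + 0)) ≡ a + suc j + (a + suc j)
    centre-index = solve-∀

  count-above : sumBelow J (λ i → 𝟙 (reflect (suc (A + (J + suc i))))) ≡ 0
  count-above = trans (sumBelow-cong J vanish) (trans (sumBelow-const J 0) (*-zeroʳ J))
    where
    vanish : ∀ i → i < J → 𝟙 (reflect (suc (A + (J + suc i)))) ≡ 0
    vanish i i<J = cong 𝟙 (trans (cong (reflect ∘ suc) (A+J+1+x≡K+x i)) (reflect-above (s≤s⁻¹ i<J)))

  count-high : sumBelow A (λ i → 𝟙 (reflect (suc (A + (J + suc (J + i)))))) ≡ a
  count-high = begin
    sumBelow A (λ i → 𝟙 (reflect (suc (A + (J + suc (J + i))))))   ≡⟨ sumBelow-cong A evens ⟩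
    sumBelow A (λ i → 𝟙 (odd (suc (suc (K + J)) + i)))             ≡⟨ sumBelow-odd a (suc (suc (K + J))) ⟩
    a                                                              ∎
    where
    open ≡-Reasoning
    evens : ∀ i → i < A → 𝟙 (reflect (suc (A + (J + suc (J + i))))) ≡ 𝟙 (odd (suc (suc (K + J)) + i))
    evens i i<A = cong 𝟙 (begin
      reflect (suc (A + (J + suc (J + i))))   ≡⟨ cong (reflect ∘ suc) (A+J+1+x≡K+x (J + i)) ⟩
      reflect (suc (K + (J + i)))             ≡⟨ reflect-high i<A ⟩
      not (odd (suc (K + (J + i))))           ≡⟨ cong (odd ∘ suc ∘ suc) (+-assoc K J i) ⟨
      odd (suc (suc (K + J)) + i)             ∎)

  reflect-count : sumBelow (N ∸ 1) (λ i → 𝟙 (reflect (suc i))) ≡ k + A + 𝟙 b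
  reflect-count = begin
    sumBelow (N ∸ 1) F                                     ≡⟨ cong (λ n → sumBelow n F) N∸1≡blocks ⟩
    sumBelow (A + (J + (1 + (J + A)))) F                   ≡⟨ sumBelow-+ A _ F ⟩
    sumBelow A F + sumBelow (J + (1 + (J + A))) (F ∘ (A +_))
      ≡⟨ cong (sumBelow A F +_) (sumBelow-+ J _ (F ∘ (A +_))) ⟩
    sumBelow A F + (sumBelow J (F ∘ (A +_)) + (F (A + (J + 0)) + sumBelow (J + A) (λ i → F (A + (J + suc i)))))
      ≡⟨ cong (λ s → sumBelow A F + (sumBelow J (F ∘ (A +_)) + (F (A + (J + 0)) + s)))
              (sumBelow-+ J A (λ i → F (A + (J + suc i)))) ⟩
    sumBelow A F + (sumBelow J (F ∘ (A +_)) + (F (A + (J + 0))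
      + (sumBelow J (λ i → F (A + (J + suc i))) + sumBelow A (λ i → F (A + (J + suc (J + i)))))))
      ≡⟨ cong₂ _+_ count-low (cong₂ _+_ count-middle (cong₂ _+_ count-centre (cong₂ _+_ count-above count-high))) ⟩
    A + (suc j + (𝟙 b + (0 + a)))                          ≡⟨ total a j (𝟙 b) ⟩
    k + A + 𝟙 b                                            ∎
    where
    open ≡-Reasoning
    F : ℕ → ℕ
    F i = 𝟙 (reflect (suc i))
    total : ∀ a j x → (a + a) + (suc j + (x + (0 + a))) ≡ (a + suc j) + (a + a) + x
    total = solve-∀

module DegreeArithmetic where

  open import Data.Nat.Base using (ℕ; suc; _+_; _*_; _∸_; _≤_; _<_)
  open import Data.Nat.Properties
  open import Data.Nat.Tactic.RingSolver using (solve-∀)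
  open import Data.Bool.Base using (Bool)
  open import Data.Product.Base using (Σ; _×_; _,_)
  open import Data.Empty using (⊥-elim)
  open import Relation.Binary.PropositionalEquality using (_≡_; sym; trans; cong; subst; module ≡-Reasoning)
  open import Relation.Nullary using (yes; no)
  open Sums
  open Parity

  necessary-bounds : ∀ k m m′ → m′ + m + 1 ≡ 4 * k → m′ < m → m ≤ 2 * k + m′ → 2 * k ≤ m × m < 3 * k
  necessary-bounds k m m′ sum≡4k m′<m m≤2k+m′ = *-cancelˡ-≤ 2 lower , *-cancelˡ-< 2 m (3 * k) upper
    where
    open ≤-Reasoning
    lower : 2 * (2 * k) ≤ 2 * m
    lower = begin
      2 * (2 * k)   ≡⟨ four k ⟩
      4 * k         ≡⟨ sum≡4k ⟨
      m′ + m + 1    ≡⟨ +-comm (m′ + m) 1 ⟩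
      suc m′ + m    ≤⟨ +-monoˡ-≤ m m′<m ⟩
      m + m         ≡⟨ double m ⟩
      2 * m         ∎
      where
      four : ∀ k → 2 * (2 * k) ≡ 4 * k
      four = solve-∀
      double : ∀ m → m + m ≡ 2 * m
      double = solve-∀
    upper : 2 * m < 2 * (3 * k)
    upper = begin-strict
      2 * m                      ≡⟨ double m ⟩
      m + m                      ≤⟨ +-monoˡ-≤ m m≤2k+m′ ⟩
      2 * k + m′ + m             <⟨ n<1+n _ ⟩
      suc (2 * k + m′ + m)       ≡⟨ regroup k m m′ ⟩
      2 * k + (m′ + m + 1)       ≡⟨ cong (2 * k +_) sum≡4k ⟩
      2 * k + 4 * k              ≡⟨ six k ⟩
      2 * (3 * k)                ∎
      where
      double : ∀ m → 2 * m ≡ m + m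
      double = solve-∀
      regroup : ∀ k m m′ → suc (2 * k + m′ + m) ≡ 2 * k + (m′ + m + 1)
      regroup = solve-∀
      six : ∀ k → 2 * k + 4 * k ≡ 2 * (3 * k)
      six = solve-∀

  sufficient-split : ∀ k m → 2 * k ≤ m → m < 3 * k →
                     Σ ℕ λ a → Σ ℕ λ j → Σ Bool λ b → a + suc j ≡ k × m ≡ k + (a + a) + 𝟙 b
  sufficient-split k m 2k≤m m<3k with halve (m ∸ k)
  ... | a , b , m∸k≡2a+b = a , k ∸ suc a , b , trans (+-suc a (k ∸ suc a)) (m+[n∸m]≡n a<k) , (begin
    m                      ≡⟨ m+[n∸m]≡n k≤m ⟨
    k + (m ∸ k)            ≡⟨ cong (k +_) m∸k≡2a+b ⟩
    k + (a + a + 𝟙 b)      ≡⟨ +-assoc k (a + a) (𝟙 b) ⟨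
    k + (a + a) + 𝟙 b      ∎)
    where
    open ≡-Reasoning
    k≤m : k ≤ m
    k≤m = ≤-trans (m≤m+n k (k + 0)) 2k≤m
    m∸k<2k : m ∸ k < k + k
    m∸k<2k = +-cancelˡ-< k (m ∸ k) (k + k) (subst (_< k + (k + k)) (sym (m+[n∸m]≡n k≤m)) (subst (m <_) (triple k) m<3k))
      where
      triple : ∀ k → 3 * k ≡ k + (k + k)
      triple = solve-∀
    a<k : a < k
    a<k with suc a ≤? k
    ... | yes a<k = a<k
    ... | no  a≮k = ⊥-elim (<⇒≱ m∸k<2k (subst (k + k ≤_) (sym m∸k≡2a+b) 2k≤2a+b))
      where
      2k≤2a+b : k + k ≤ a + a + 𝟙 b
      2k≤2a+b = ≤-trans (+-mono-≤ (≮⇒≥ a≮k) (≮⇒≥ a≮k)) (m≤m+n (a + a) (𝟙 b))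

module Necessity where

  open import Data.Nat.Base as ℕ using (ℕ; suc; _*_; s≤s)
  open import Data.Nat.Properties using (*-cancelˡ-≤; *-distribˡ-+; <⇒≢; 0≢1+n)
  open import Data.Nat.Tactic.RingSolver renaming (solve-∀ to solve-ℕ)
  open import Data.Integer.Base using (ℤ; +_; -[1+_]; _+_; _-_; _≤_; _<_; +≤+; +<+)
  open import Data.Integer.Properties using (+-injective)
  open import Data.Integer.Tactic.RingSolver using (solve-∀)
  open import Data.Product.Base using (Σ; _×_; _,_)
  open import Data.Empty using (⊥-elim)
  open import Relation.Binary.PropositionalEquality using (_≡_; refl; sym; trans; cong; cong₂; subst; subst₂)
  open import Function.Base using (_∘_)
  open import Defs hiding (sym)
  open GraphCounting
  open DegreeArithmetic

  degree-bounds : ∀ k′ (G : Graph (4 * suc k′)) m m′ → + m′ ≡ + (4 * suc k′) - + 1 - + m → m′ ℕ.< m →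
                  countDeg G (+ m) ≡ 2 * suc k′ → countDeg G (+ m′) ≡ 2 * suc k′ →
                  2 * suc k′ ℕ.≤ m × m ℕ.< 3 * suc k′
  degree-bounds k′ G m m′ m′≡ m′<m count-m count-m′ = necessary-bounds k m m′ sum≡4k m′<m m≤K+m′
    where
    k K : ℕ
    k = suc k′
    K = 2 * k
    sum≡4k : m′ ℕ.+ m ℕ.+ 1 ≡ 4 * k
    sum≡4k = +-injective (trans (cong (λ x → x + + m + + 1) m′≡) (cancel (+ (4 * k)) (+ m)))
      where
      cancel : ∀ (n d : ℤ) → (n - + 1 - d) + d + + 1 ≡ n
      cancel = solve-∀
    covers : countDeg G (+ m) ℕ.+ countDeg G (+ m′) ≡ 4 * k
    covers = trans (cong₂ ℕ._+_ count-m count-m′) (double k′)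
      where
      double : ∀ k′ → 2 * suc k′ ℕ.+ 2 * suc k′ ≡ 4 * suc k′
      double = solve-ℕ
    m≤K+m′ : m ℕ.≤ K ℕ.+ m′
    m≤K+m′ = *-cancelˡ-≤ K (subst (K * m ℕ.≤_) (sym (*-distribˡ-+ K K m′)) bound)
      where
      bound : K * m ℕ.≤ K * K ℕ.+ K * m′
      bound = subst₂ (λ c c′ → c * m ℕ.≤ c * c ℕ.+ c′ * m′) count-m count-m′
                     (two-degree-bound G (<⇒≢ m′<m ∘ sym) covers)

  necessity : ∀ k′ d → (+ (4 * suc k′) - + 1 - d) < d →
    (Σ (Graph (4 * suc k′)) λ G → SelfComplementary G
       × countDeg G d ≡ 2 * suc k′
       × countDeg G (+ (4 * suc k′) - + 1 - d) ≡ 2 * suc k′) →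
    (+ (2 * suc k′) ≤ d) × (d ≤ + (3 * suc k′) - + 1)
  necessity k′ -[1+ x ] _   (G , _ , count-d , _)       = ⊥-elim (0≢1+n (trans (sym (countDeg-negative G x)) count-d))
  necessity k′ (+ m)    e<d (G , _ , count-d , count-e) = bounds-in-ℤ (bounds _ refl e<d count-e)
    where
    bounds : ∀ e → e ≡ + (4 * suc k′) - + 1 - + m → e < + m → countDeg G e ≡ 2 * suc k′ →
             2 * suc k′ ℕ.≤ m × m ℕ.< 3 * suc k′
    bounds -[1+ x ] _  _            count-e = ⊥-elim (0≢1+n (trans (sym (countDeg-negative G x)) count-e))
    bounds (+ m′)   e≡ (+<+ m′<m)  count-e = degree-bounds k′ G m m′ e≡ m′<m count-d count-e
    bounds-in-ℤ : 2 * suc k′ ℕ.≤ m × m ℕ.< 3 * suc k′ → (+ (2 * suc k′) ≤ + m) × (+ m ≤ + (3 * suc k′) - + 1)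
    bounds-in-ℤ (2k≤m , s≤s m≤3k-1) = +≤+ 2k≤m , +≤+ m≤3k-1

module Sufficiency where

  open import Data.Nat.Base as ℕ using (ℕ; zero; suc; _*_; _∸_; s≤s)
  open import Data.Nat.Properties using (+-identityʳ)
  open import Data.Nat.Tactic.RingSolver using (solve-∀)
  open import Data.Bool.Base using (Bool)
  open import Data.Integer.Base using (+_; _-_; _≤_; +≤+)
  open import Data.Integer.Properties using (⊖-≥)
  open import Data.Product.Base using (Σ; _×_; _,_)
  open import Relation.Binary.PropositionalEquality using (_≡_; refl; sym; trans; cong; subst; module ≡-Reasoning)
  open import Defs hiding (sym)
  open Sums
  open Parity
  open DegreeArithmetic

  pattern-with-count : ∀ k m → 2 * k ℕ.≤ m → m ℕ.< 3 * k →
                       Σ (ℕ → Bool) λ h → ParitySymmetric (4 * k) h × sumBelow (4 * k ∸ 1) (λ i → 𝟙 (h (suc i))) ≡ m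
  pattern-with-count k m 2k≤m m<3k with sufficient-split k m 2k≤m m<3k
  ... | a , j , b , refl , refl = reflect , reflect-symmetric , reflect-count
    where open Pattern a j b

  [1+M]-1-m≡M∸m : ∀ M m → m ℕ.≤ M → + suc M - + 1 - + m ≡ + (M ∸ m)
  [1+M]-1-m≡M∸m M zero    _   = cong +_ (+-identityʳ M)
  [1+M]-1-m≡M∸m M (suc m) m<M = ⊖-≥ m<M

  sufficiency : ∀ k′ d → + (2 * suc k′) ≤ d → d ≤ + (3 * suc k′) - + 1 →
    Σ (Graph (4 * suc k′)) λ G →
      countDeg G d ≡ 2 * suc k′
      × countDeg G (+ (4 * suc k′) - + 1 - d) ≡ 2 * suc k′
      × Σ _ λ σ → IsAntimorphism G σ × SingleCycle σ
  sufficiency k′ (+ m) (+≤+ 2k≤m) (+≤+ m≤3k-1) with pattern-with-count (suc k′) m 2k≤m (s≤s m≤3k-1)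
  ... | h , h-sym , evenDegree≡m = graph , count-m , count-complement , rotate , rotate-antimorphism , rotate-single-cycle
    where
    k M : ℕ
    k = suc k′
    M = 4 * k ∸ 1
    N≡K+K : suc M ≡ (k ℕ.+ k) ℕ.+ (k ℕ.+ k)
    N≡K+K = quadruple k′
      where
      quadruple : ∀ k′ → 4 * suc k′ ≡ (suc k′ ℕ.+ suc k′) ℕ.+ (suc k′ ℕ.+ suc k′)
      quadruple = solve-∀
    open Circulant M (k ℕ.+ k) N≡K+K h h-sym
    open Rotation M using (rotate; rotate-single-cycle)
    k+k≡2k : k ℕ.+ k ≡ 2 * k
    k+k≡2k = cong (k ℕ.+_) (sym (+-identityʳ k))
    count-m : countDeg graph (+ m) ≡ 2 * k
    count-m = subst (λ e → countDeg graph (+ e) ≡ 2 * k) evenDegree≡m (trans countDeg-evenDegree k+k≡2k)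
    count-complement : countDeg graph (+ (4 * k) - + 1 - + m) ≡ 2 * k
    count-complement = begin
      countDeg graph (+ (4 * k) - + 1 - + m)   ≡⟨ cong (countDeg graph) ([1+M]-1-m≡M∸m M m m≤M) ⟩
      countDeg graph (+ (M ∸ m))               ≡⟨ cong (λ e → countDeg graph (+ (M ∸ e))) evenDegree≡m ⟨
      countDeg graph (+ (M ∸ evenDegree))      ≡⟨ countDeg-oddDegree ⟩
      k ℕ.+ k                                  ≡⟨ k+k≡2k ⟩
      2 * k                                    ∎
      where
      open ≡-Reasoning
      m≤M : m ℕ.≤ M
      m≤M = subst (ℕ._≤ M) evenDegree≡m evenDegree≤M

  self-complementary-realisation : ∀ k′ d → + (2 * suc k′) ≤ d → d ≤ + (3 * suc k′) - + 1 →
    Σ (Graph (4 * suc k′)) λ G → SelfComplementary G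
      × countDeg G d ≡ 2 * suc k′
      × countDeg G (+ (4 * suc k′) - + 1 - d) ≡ 2 * suc k′
  self-complementary-realisation k′ d 2k≤d d≤3k-1 with sufficiency k′ d 2k≤d d≤3k-1
  ... | G , count-d , count-e , σ , σ-anti , _ = G , (σ , σ-anti) , count-d , count-e

open import Defs
open import Data.Nat using (ℕ; zero; suc; _*_; NonZero)
open import Data.Integer using (ℤ; +_; _-_; _≤_; _<_)
open import Data.Product using (Σ; _×_; _,_; uncurry)
open import Function.Bundles using (_⇔_; mk⇔)
open import Relation.Binary.PropositionalEquality using (_≡_)
open import Data.Empty using (⊥-elim-irr)
open Necessity using (necessity)
open Sufficiency using (sufficiency; self-complementary-realisation)

proposition13 : (k : ℕ) → .{{_ : NonZero k}} → (d : ℤ) →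
    (+ (4 * k) - + 1 - d) < d →
    ((Σ (Graph (4 * k)) λ G → SelfComplementary G
        × countDeg G d ≡ 2 * k
        × countDeg G (+ (4 * k) - + 1 - d) ≡ 2 * k)
      ⇔ ((+ (2 * k) ≤ d) × (d ≤ + (3 * k) - + 1)))
    × ((+ (2 * k) ≤ d) → (d ≤ + (3 * k) - + 1) →
        Σ (Graph (4 * k)) λ G →
          countDeg G d ≡ 2 * k
          × countDeg G (+ (4 * k) - + 1 - d) ≡ 2 * k
          × Σ _ λ σ → IsAntimorphism G σ × SingleCycle σ)
proposition13 zero     {{k≢0}} _ _   = ⊥-elim-irr (NonZero.nonZero k≢0)
proposition13 (suc k′) d       e<d = mk⇔ (necessity k′ d e<d) (uncurry (self-complementary-realisation k′ d))
                                   , sufficiency k′ d
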